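{- Let $G$ be a graph having the Pairing-Hamiltonian property. Then, for each integer $k\geq 0$, the graph $\mathcal{P}^k(G)$ has the Pairing-Hamiltonian property.
   Context: All graphs are finite and simple. For a graph $G$, let $K_G$ denote the complete graph on the vertex set $V(G)$. If $G$ has even order, a perfect matching of $K_G$ is called a pairing of $G$. A pairing $M$ of $G$ can be extended to a Hamiltonian cycle if there exists a perfect matching $N$ of $G$ (using only edges of $G$) such that $M\cup N$ is the edge set of a Hamiltonian cycle of $K_G$. A graph $G$ of even order has the Pairing-Hamiltonian property (PH-property) if every pairing of $G$ can be extended to a Hamiltonian cycle in this sense. The prism graph $\mathcal{P}(G)$ is the Cartesian product $G\,\Box\,K_2$, i.e. two copies of $G$ with an edge joining each vertex to its copy. Define $\mathcal{P}^0(G)=G$ and $\mathcal{P}^k(G)=\mathcal{P}(\mathcal{P}^{k-1}(G))$ for $k\geq 1$. -}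

module Defs where

open import Data.Nat using (ℕ; zero; suc; _+_)
open import Data.Fin using (Fin; toℕ; splitAt; _≟_)
open import Data.Bool using (Bool; true; false)
open import Data.Sum using (_⊎_; inj₁; inj₂)
open import Data.Product using (Σ; ∃; _×_; _,_)
open import Relation.Nullary using (¬_; yes; no)
open import Relation.Nullary.Decidable using (⌊_⌋)
open import Relation.Binary.PropositionalEquality using (_≡_; refl; sym)
open import Function.Bundles using (_⇔_)
open import Function.Definitions using (Injective)

record Graph : Set where
  field
    order  : ℕ
    adj    : Fin order → Fin order → Bool
    adj-sym    : ∀ x y → adj x y ≡ adj y x
    adj-irrefl : ∀ x → adj x x ≡ false
open Graph public

-- Prism: vertices Fin (n + n); the first n are copy 1, the last n copy 2.
prismAdj : (n : ℕ) → (Fin n → Fin n → Bool) → Fin (n + n) → Fin (n + n) → Bool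
prismAdj n e x y with splitAt n x | splitAt n y
... | inj₁ a | inj₁ b = e a b
... | inj₂ a | inj₂ b = e a b
... | inj₁ a | inj₂ b = ⌊ a ≟ b ⌋
... | inj₂ a | inj₁ b = ⌊ a ≟ b ⌋

private
  dec-sym : ∀ {n} (a b : Fin n) → ⌊ a ≟ b ⌋ ≡ ⌊ b ≟ a ⌋
  dec-sym a b with a ≟ b | b ≟ a
  ... | yes _ | yes _ = refl
  ... | no _ | no _ = refl
  ... | yes p | no q with q (sym p)
  ... | ()
  dec-sym a b | no q | yes p with q (sym p)
  ... | ()

prismAdj-sym : ∀ n e → (∀ x y → e x y ≡ e y x) → ∀ x y → prismAdj n e x y ≡ prismAdj n e y x
prismAdj-sym n e s x y with splitAt n x | splitAt n y
... | inj₁ a | inj₁ b = s a b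
... | inj₂ a | inj₂ b = s a b
... | inj₁ a | inj₂ b = dec-sym a b
... | inj₂ a | inj₁ b = dec-sym a b

prismAdj-irrefl : ∀ n e → (∀ x → e x x ≡ false) → ∀ x → prismAdj n e x x ≡ false
prismAdj-irrefl n e ir x with splitAt n x
... | inj₁ a = ir a
... | inj₂ a = ir a

prism : Graph → Graph
prism G = record
  { order = order G + order G
  ; adj = prismAdj (order G) (adj G)
  ; adj-sym = prismAdj-sym (order G) (adj G) (adj-sym G)
  ; adj-irrefl = prismAdj-irrefl (order G) (adj G) (adj-irrefl G)
  }

prismPow : ℕ → Graph → Graph
prismPow zero G = G
prismPow (suc k) G = prism (prismPow k G)

Even : ℕ → Set
Even n = ∃ λ m → n ≡ m + m

-- A perfect matching of K_G, given as a fixed-point-free involution (x ↦ partner of x).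
record Pairing (G : Graph) : Set where
  field
    partner : Fin (order G) → Fin (order G)
    invol   : ∀ x → partner (partner x) ≡ x
    noFix   : ∀ x → ¬ (partner x ≡ x)
open Pairing public

record PerfectMatching (G : Graph) : Set where
  field
    pairing  : Pairing G
    inGraph  : ∀ x → adj G x (partner pairing x) ≡ true
open PerfectMatching public

CyclicSucc : ∀ {n} → Fin n → Fin n → Set
CyclicSucc {n} i j = (suc (toℕ i) ≡ toℕ j) ⊎ ((suc (toℕ i) ≡ n) × (toℕ j ≡ 0))

-- Edge relation of the Hamiltonian cycle of K_G given by the cyclic vertex
-- ordering v 0, v 1, ..., v (n-1) (v injective, hence a bijection).
CycleEdge : ∀ {n} → (Fin n → Fin n) → Fin n → Fin n → Set
CycleEdge v x y = ∃ λ i → ∃ λ j → CyclicSucc i j ×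
  ((v i ≡ x × v j ≡ y) ⊎ (v i ≡ y × v j ≡ x))

UnionIsHamCycle : (G : Graph) → Pairing G → Pairing G → Set
UnionIsHamCycle G M N =
  Σ (Fin (order G) → Fin (order G)) λ v → Injective _≡_ _≡_ v ×
    (∀ x y → ((partner M x ≡ y) ⊎ (partner N x ≡ y)) ⇔ CycleEdge v x y)

Extendable : (G : Graph) → Pairing G → Set
Extendable G M = Σ (PerfectMatching G) λ N → UnionIsHamCycle G M (pairing N)

HasPH : Graph → Set
HasPH G = Even (order G) × (∀ (M : Pairing G) → Extendable G M)

-- A pairing is a fixed-point-free involution, and for pairings M, N the union M ∪ N is a
-- Hamiltonian cycle iff every vertex set closed under M and N is empty or everything: the cycle is
-- then the M/N-alternating walk from any vertex.  By induction on k it suffices to extend any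
-- pairing M of P(G) when G has the PH-property.  Let M₁, M₂ be the pairs of M inside the two
-- copies of G, and A the vertices of copy 1 that M matches across.
-- If A = ∅, extend M₁ to a perfect matching N₁ of G, mark one N₁-edge in every cycle of M₂ ∪ N₁,
-- and use N₁ in both copies except that the marked edges are replaced by the rungs at their ends:
-- this splices every cycle of copy 2 into the Hamiltonian cycle M₁ ∪ N₁ of copy 1.
-- If A ≠ ∅, complete M₁ by any pairing of A and extend it to N₁.  The M₁/N₁-alternating paths of
-- copy 1 pair up A anew; carried across by M, this pairing completes M₂ to a pairing P₂ of copy 2,
-- which extends to N₂.  Then M ∪ N₁ ∪ N₂ is the Hamiltonian cycle P₂ ∪ N₂ of copy 2 with every
-- P₂-pair on the crossing vertices replaced by a detour through copy 1.

module Submission where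

open import Defs
open import Data.Nat using (ℕ; zero; suc; _+_; _∸_; _≤_; _<_; z≤n; s≤s; _<?_; _≤?_; s≤s⁻¹)
open import Data.Nat.Properties
open import Data.Nat.GeneralisedArithmetic using (fold; fold-+)
open import Data.Fin as F using (Fin; toℕ; fromℕ<; _↑ˡ_; _↑ʳ_; splitAt)
open import Data.Fin.Properties as FP using (pigeonhole; cantor-schröder-bernstein; toℕ-injective; injective⇒≤; toℕ<n; toℕ-fromℕ<; fromℕ<-toℕ; splitAt-↑ˡ; splitAt-↑ʳ; splitAt⁻¹-↑ˡ; splitAt⁻¹-↑ʳ; ↑ˡ-injective; ↑ʳ-injective)
open import Data.Bool using (Bool; true; false; _∨_; if_then_else_)
import Data.Bool.Properties as BP
open import Data.Sum using (_⊎_; inj₁; inj₂; [_,_]′)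
open import Data.Product using (Σ; ∃; _×_; _,_; proj₁; proj₂)
open import Data.Empty using (⊥-elim)
open import Relation.Nullary using (¬_; Dec; yes; no)
open import Relation.Nullary.Decidable using (isYes; _×-dec_)
open import Relation.Binary.PropositionalEquality
open import Relation.Binary.Definitions using (tri<; tri≈; tri>)
open import Function.Bundles using (_⇔_; mk⇔; Equivalence)
open import Function.Definitions using (Injective)

fold-suc′ : ∀ {A : Set} (x : A) (f : A → A) k → fold x f (suc k) ≡ fold (f x) f k
fold-suc′ x f zero = refl
fold-suc′ x f (suc k) = cong f (fold-suc′ x f k)

fold-inverse : ∀ {A : Set} (f g : A → A) → (∀ x → g (f x) ≡ x) → ∀ k x → fold (fold x f k) g k ≡ x
fold-inverse f g gf zero x = refl
fold-inverse f g gf (suc k) x = begin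
  fold (f (fold x f k)) g (suc k)  ≡⟨ fold-suc′ _ g k ⟩
  fold (g (f (fold x f k))) g k    ≡⟨ cong (λ y → fold y g k) (gf _) ⟩
  fold (fold x f k) g k            ≡⟨ fold-inverse f g gf k x ⟩
  x                                ∎
  where open ≡-Reasoning

even⊎odd : ∀ i → ∃ λ k → (i ≡ k + k) ⊎ (i ≡ suc (k + k))
even⊎odd zero = 0 , inj₁ refl
even⊎odd (suc i) with even⊎odd i
... | k , inj₁ e = k , inj₂ (cong suc e)
... | k , inj₂ e = suc k , inj₁ (trans (cong suc e) (cong suc (sym (+-suc k k))))

suc+suc : ∀ k → suc k + suc k ≡ suc (suc (k + k))
suc+suc k = cong suc (+-suc k k)

m+m<n+n⇒m<n : ∀ {m n} → m + m < n + n → m < n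
m+m<n+n⇒m<n h = ≰⇒> λ n≤m → <⇒≱ h (+-mono-≤ n≤m n≤m)

module LeastWitness {P : ℕ → Set} (P? : ∀ k → Dec (P k)) where
  Least : ℕ → Set
  Least k = P k × (∀ j → j < k → ¬ P j)

  search : ∀ m → (∃ λ k → k ≤ m × Least k) ⊎ (∀ j → j ≤ m → ¬ P j)
  search zero with P? 0
  ... | yes p = inj₁ (0 , z≤n , p , λ j ())
  ... | no np = inj₂ λ { zero _ → np }
  search (suc m) with search m
  ... | inj₁ (k , k≤m , l) = inj₁ (k , m≤n⇒m≤1+n k≤m , l)
  ... | inj₂ none with P? (suc m)
  ...   | yes p = inj₁ (suc m , ≤-refl , p , λ j j<sm → none j (s≤s⁻¹ j<sm))
  ...   | no np = inj₂ λ j j≤sm → lem j (m≤n⇒m<n∨m≡n j≤sm)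
    where
    lem : ∀ j → j < suc m ⊎ j ≡ suc m → ¬ P j
    lem j (inj₁ lt) = none j (s≤s⁻¹ lt)
    lem j (inj₂ refl) = np

  least : ∀ m → P m → ∃ λ k → Least k
  least m p with search m
  ... | inj₁ (k , _ , l) = k , l
  ... | inj₂ none = ⊥-elim (none m ≤-refl p)

  least-unique : ∀ {k k′} → Least k → Least k′ → k ≡ k′
  least-unique {k} {k′} (p , earliest) (p′ , earliest′) with <-cmp k k′
  ... | tri< k<k′ _ _ = ⊥-elim (earliest′ k k<k′ p)
  ... | tri≈ _ k≡k′ _ = k≡k′
  ... | tri> _ _ k′<k = ⊥-elim (earliest k′ k′<k p′)

isYes-sound : ∀ {A : Set} (d : Dec A) → isYes d ≡ true → A
isYes-sound (yes a) _ = a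

isYes-complete : ∀ {A : Set} (d : Dec A) → A → isYes d ≡ true
isYes-complete (yes _) _ = refl
isYes-complete (no na) a = ⊥-elim (na a)

argmin-below : ∀ {n} (f : ℕ → Fin n) L → 0 < L → ∃ λ i → i < L × (∀ j → j < L → toℕ (f i) ≤ toℕ (f j))
argmin-below f (suc zero) _ = 0 , s≤s z≤n , λ { zero _ → ≤-refl ; (suc j) (s≤s ()) }
argmin-below f (suc (suc L)) _ with argmin-below f (suc L) (s≤s z≤n)
... | i , hi , mi with toℕ (f i) ≤? toℕ (f (suc L))
...   | yes le = i , m<n⇒m<1+n hi , λ j hj → lem j (m≤n⇒m<n∨m≡n (s≤s⁻¹ hj))
  where
  lem : ∀ j → j < suc L ⊎ j ≡ suc L → toℕ (f i) ≤ toℕ (f j)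
  lem j (inj₁ lt) = mi j lt
  lem j (inj₂ refl) = le
...   | no nle = suc L , ≤-refl , λ j hj → lem j (m≤n⇒m<n∨m≡n (s≤s⁻¹ hj))
  where
  lem : ∀ j → j < suc L ⊎ j ≡ suc L → toℕ (f (suc L)) ≤ toℕ (f j)
  lem j (inj₁ lt) = ≤-trans (<⇒≤ (≰⇒> nle)) (mi j lt)
  lem j (inj₂ refl) = ≤-refl

odd≢even : ∀ a b → suc (a + a) ≢ b + b
odd≢even zero zero ()
odd≢even zero (suc b) e = 0≢1+n (trans (suc-injective e) (+-suc b b))
odd≢even (suc a) zero ()
odd≢even (suc a) (suc b) e = odd≢even a b (suc-injective
  (trans (sym (cong suc (+-suc a a))) (trans (suc-injective e) (+-suc b b))))

-- Alternating walks of two involutions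

module Alternating {n : ℕ} (α β : Fin n → Fin n)
         (α-invol : ∀ x → α (α x) ≡ x) (β-invol : ∀ x → β (β x) ≡ x) where
  open ≡-Reasoning

  φ : Fin n → Fin n
  φ x = β (α x)

  ψ : Fin n → Fin n
  ψ x = α (β x)

  ψφ-cancel : ∀ x → ψ (φ x) ≡ x
  ψφ-cancel x = trans (cong α (β-invol (α x))) (α-invol x)

  φψ-cancel : ∀ x → φ (ψ x) ≡ x
  φψ-cancel x = trans (cong β (α-invol (β x))) (β-invol x)

  Φ : ℕ → Fin n → Fin n
  Φ k x = fold x φ k

  Ψ : ℕ → Fin n → Fin n
  Ψ k x = fold x ψ k

  ΨΦ-cancel : ∀ k x → Ψ k (Φ k x) ≡ x
  ΨΦ-cancel k x = fold-inverse φ ψ ψφ-cancel k x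

  ΦΨ-cancel : ∀ k x → Φ k (Ψ k x) ≡ x
  ΦΨ-cancel k x = fold-inverse ψ φ φψ-cancel k x

  α-Φ : ∀ k x → α (Φ k x) ≡ Ψ k (α x)
  α-Φ zero x = refl
  α-Φ (suc k) x = cong ψ (α-Φ k x)

  α-Ψ : ∀ k x → α (Ψ k x) ≡ Φ k (α x)
  α-Ψ zero x = refl
  α-Ψ (suc k) x = trans (α-invol (β (Ψ k x)))
    (cong β (trans (sym (α-invol (Ψ k x))) (cong α (α-Ψ k x))))

  Φ-injective : ∀ k {x y} → Φ k x ≡ Φ k y → x ≡ y
  Φ-injective k {x} {y} e = trans (sym (ΨΦ-cancel k x)) (trans (cong (Ψ k) e) (ΨΦ-cancel k y))

  Φ-+ : ∀ a b x → Φ (a + b) x ≡ Φ a (Φ b x)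
  Φ-+ a b x = fold-+ x φ a

  Φ-cancelˡ : ∀ a d x → Φ a x ≡ Φ (a + d) x → x ≡ Φ d x
  Φ-cancelˡ a d x e = Φ-injective a (trans e (Φ-+ a d x))

  Φ≡αΦ⇒Φ≡α : ∀ i j x → Φ i x ≡ α (Φ j x) → Φ (j + i) x ≡ α x
  Φ≡αΦ⇒Φ≡α i j x e = trans (Φ-+ j i x) (trans (cong (Φ j) (trans e (α-Φ j x))) (ΦΨ-cancel j (α x)))

  -- A walk from x that reaches α x retraces itself, so it turns around at its midpoint, which is
  -- fixed by α or by β.
  Φ≡α⇒turn : ∀ s x → Φ s x ≡ α x → ∃ λ t →
    (s ≡ t + t × α (Φ t x) ≡ Φ t x) ⊎ (s ≡ suc (t + t) × β (α (Φ t x)) ≡ α (Φ t x))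
  Φ≡α⇒turn s x e with even⊎odd s
  ... | t , inj₁ refl = t , inj₁ (refl , (begin
    α (Φ t x)                ≡⟨ α-Φ t x ⟩
    Ψ t (α x)                ≡⟨ cong (Ψ t) (sym e) ⟩
    Ψ t (Φ (t + t) x)        ≡⟨ cong (Ψ t) (Φ-+ t t x) ⟩
    Ψ t (Φ t (Φ t x))        ≡⟨ ΨΦ-cancel t (Φ t x) ⟩
    Φ t x                    ∎))
  ... | t , inj₂ refl = t , inj₂ (refl , sym (begin
    α (Φ t x)                ≡⟨ α-Φ t x ⟩
    Ψ t (α x)                ≡⟨ cong (Ψ t) (sym e) ⟩
    Ψ t (Φ (suc (t + t)) x)  ≡⟨ cong (λ k → Ψ t (Φ k x)) (sym (+-suc t t)) ⟩
    Ψ t (Φ (t + suc t) x)    ≡⟨ cong (Ψ t) (Φ-+ t (suc t) x) ⟩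
    Ψ t (Φ t (Φ (suc t) x))  ≡⟨ ΨΦ-cancel t (Φ (suc t) x) ⟩
    Φ (suc t) x              ∎))

  Φ-reverse : ∀ j d x → α (Φ j (α (Φ (j + d) x))) ≡ Φ d x
  Φ-reverse j d x = begin
    α (Φ j (α (Φ (j + d) x)))  ≡⟨ cong (λ z → α (Φ j z)) (α-Φ (j + d) x) ⟩
    α (Φ j (Ψ (j + d) (α x)))  ≡⟨ cong (λ z → α (Φ j z)) (fold-+ (α x) ψ j) ⟩
    α (Φ j (Ψ j (Ψ d (α x))))  ≡⟨ cong α (ΦΨ-cancel j _) ⟩
    α (Ψ d (α x))              ≡⟨ α-Ψ d (α x) ⟩
    Φ d (α (α x))              ≡⟨ cong (Φ d) (α-invol x) ⟩
    Φ d x                      ∎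

  Φ-reverse-full : ∀ k x → α (Φ k (α (Φ k x))) ≡ x
  Φ-reverse-full k x = subst (λ t → α (Φ k (α (Φ t x))) ≡ x) (+-identityʳ k) (Φ-reverse k 0 x)

  walk : Fin n → ℕ → Fin n
  walk x zero = x
  walk x (suc zero) = α x
  walk x (suc (suc i)) = walk (φ x) i

  walk-even : ∀ k x → walk x (k + k) ≡ Φ k x
  walk-even zero x = refl
  walk-even (suc k) x rewrite +-suc k k = trans (walk-even k (φ x)) (sym (fold-suc′ x φ k))

  walk-odd : ∀ k x → walk x (suc (k + k)) ≡ α (Φ k x)
  walk-odd zero x = refl
  walk-odd (suc k) x rewrite +-suc k k = trans (walk-odd k (φ x)) (cong α (sym (fold-suc′ x φ k)))

  walk-shift : ∀ k i x → walk x (k + k + i) ≡ walk (Φ k x) i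
  walk-shift zero i x = refl
  walk-shift (suc k) i x rewrite +-suc k k =
    trans (walk-shift k i (φ x)) (cong (λ z → walk z i) (sym (fold-suc′ x φ k)))

  walk-step : ∀ i x → (∃ λ k → i ≡ k + k × walk x (suc i) ≡ α (walk x i))
                    ⊎ (∃ λ k → i ≡ suc (k + k) × walk x (suc i) ≡ β (walk x i))
  walk-step i x with even⊎odd i
  ... | k , inj₁ refl = inj₁ (k , refl , trans (walk-odd k x) (cong α (sym (walk-even k x))))
  ... | k , inj₂ refl = inj₂ (k , refl ,
          trans (cong (walk x) (sym (suc+suc k)))
            (trans (walk-even (suc k) x) (cong β (sym (walk-odd k x)))))

  Φ-returns : ∀ x → ∃ λ p → 0 < p × Φ p x ≡ x
  Φ-returns x with pigeonhole (n<1+n n) (λ (i : Fin (suc n)) → Φ (toℕ i) x)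
  ... | i , j , i<j , eq =
    toℕ j ∸ toℕ i , m<n⇒0<n∸m i<j ,
    sym (Φ-cancelˡ (toℕ i) (toℕ j ∸ toℕ i) x
      (trans eq (cong (λ k → Φ k x) (sym (m+[n∸m]≡n (<⇒≤ i<j))))))

  record Period (x : Fin n) : Set where
    field
      p : ℕ
      p>0 : 0 < p
      returns : Φ p x ≡ x
      minimal : ∀ j → 0 < j → j < p → Φ j x ≢ x

  returns? : ∀ x k → Dec (0 < k × Φ k x ≡ x)
  returns? x k = (0 <? k) ×-dec (Φ k x F.≟ x)

  abstract
   period : ∀ x → Period x
   period x with LeastWitness.least (returns? x) (proj₁ (Φ-returns x)) (proj₂ (Φ-returns x))
   ... | k , l = record { p = k ; p>0 = proj₁ (proj₁ l) ; returns = proj₂ (proj₁ l) ;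
                   minimal = λ j j>0 j<k e → proj₂ l j j<k (j>0 , e) }

  len : Fin n → ℕ
  len x = Period.p (period x) + Period.p (period x)

  Reachable : Fin n → Fin n → Set
  Reachable x z = ∃ λ i → walk x i ≡ z

  walk-reaches-β : ∀ x p → 0 < p → Φ p x ≡ x → ∃ λ q → p ≡ suc q × walk x (suc (q + q)) ≡ β x
  walk-reaches-β x (suc q) _ e = q , refl , trans (walk-odd q x) (trans (sym (β-invol _)) (cong β e))

  reachable-α : ∀ {x z} → Reachable x z → Reachable x (α z)
  reachable-α {x} (i , refl) with even⊎odd i
  ... | k , inj₁ refl = suc (k + k) , trans (walk-odd k x) (cong α (sym (walk-even k x)))
  ... | k , inj₂ refl = k + k , trans (walk-even k x) (sym (trans (cong α (walk-odd k x)) (α-invol _)))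

  reachable-β : ∀ {x z} → Reachable x z → Reachable x (β z)
  reachable-β {x} (i , refl) with even⊎odd i
  ... | zero , inj₁ refl with walk-reaches-β x (Period.p (period x)) (Period.p>0 (period x)) (Period.returns (period x))
  ...   | q , _ , e = suc (q + q) , e
  reachable-β {x} (i , refl) | suc k , inj₁ refl =
    suc (k + k) , trans (walk-odd k x) (sym (trans (cong β (walk-even (suc k) x)) (β-invol _)))
  reachable-β {x} (i , refl) | k , inj₂ refl =
    suc k + suc k , trans (walk-even (suc k) x) (cong β (sym (walk-odd k x)))

  len>0 : ∀ x → 0 < len x
  len>0 x = <-≤-trans (Period.p>0 (period x)) (m≤m+n _ _)

  reachable-below : ∀ x fuel i → i ≤ fuel → ∃ λ j → j < len x × walk x j ≡ walk x i
  reachable-below x zero zero _ = 0 , len>0 x , refl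
  reachable-below x (suc f) i h with i <? len x
  ... | yes lt = i , lt , refl
  ... | no nlt with reachable-below x f (i ∸ len x) d≤f
    where
    d≤f : i ∸ len x ≤ f
    d≤f = ≤-trans (∸-monoʳ-≤ i (len>0 x)) (∸-monoˡ-≤ 1 h)
  ... | j , j< , e = j , j< , trans e (trans (cong (λ z → walk z (i ∸ len x)) (sym (Period.returns (period x))))
          (trans (sym (walk-shift (Period.p (period x)) (i ∸ len x) x)) (cong (walk x) (m+[n∸m]≡n (≮⇒≥ nlt)))))

  reachable-within-len : ∀ {x z} → Reachable x z → ∃ λ j → j < len x × walk x j ≡ z
  reachable-within-len {x} (i , refl) = reachable-below x i i ≤-refl

  reachable? : ∀ x z → Dec (∃ λ i → i < len x × walk x i ≡ z)
  reachable? x z = anyUpTo? (λ i → walk x i F.≟ z) (len x)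

  reaches : Fin n → Fin n → Bool
  reaches x z = isYes (reachable? x z)

  reaches-intro : ∀ {x z} → Reachable x z → reaches x z ≡ true
  reaches-intro {x} {z} w = isYes-complete (reachable? x z) (reachable-within-len w)

  reaches-elim : ∀ {x z} → reaches x z ≡ true → ∃ λ i → i < len x × walk x i ≡ z
  reaches-elim {x} {z} e = isYes-sound (reachable? x z) e

  reaches-α : ∀ {x z} → reaches x z ≡ true → reaches x (α z) ≡ true
  reaches-α e with reaches-elim e
  ... | i , _ , w = reaches-intro (reachable-α (i , w))

  reaches-β : ∀ {x z} → reaches x z ≡ true → reaches x (β z) ≡ true
  reaches-β e with reaches-elim e
  ... | i , _ , w = reaches-intro (reachable-β (i , w))

  Φ-no-early-return : ∀ x {a b} → a < b → b < Period.p (period x) → Φ a x ≢ Φ b x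
  Φ-no-early-return x {a} {b} a<b b<p e =
    Period.minimal (period x) (b ∸ a) (m<n⇒0<n∸m a<b) (≤-<-trans (m∸n≤m b a) b<p)
      (sym (Φ-cancelˡ a (b ∸ a) x (trans e (cong (λ k → Φ k x) (sym (m+[n∸m]≡n (<⇒≤ a<b)))))))

  module FixedPointFree (α-fpf : ∀ x → α x ≢ x) (β-fpf : ∀ x → β x ≢ x) where
    Φ≢αΦ : ∀ i j x → Φ i x ≢ α (Φ j x)
    Φ≢αΦ i j x e with Φ≡α⇒turn (j + i) x (Φ≡αΦ⇒Φ≡α i j x e)
    ... | t , inj₁ (_ , f) = α-fpf _ f
    ... | t , inj₂ (_ , f) = β-fpf _ f

    Φ-injective-within-period : ∀ x a b → a < Period.p (period x) → b < Period.p (period x) →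
                                Φ a x ≡ Φ b x → a ≡ b
    Φ-injective-within-period x a b ha hb e with <-cmp a b
    ... | tri< a<b _ _ = ⊥-elim (Φ-no-early-return x a<b hb e)
    ... | tri≈ _ a≡b _ = a≡b
    ... | tri> _ _ b<a = ⊥-elim (Φ-no-early-return x b<a ha (sym e))

    walk-injective : ∀ x i j → i < len x → j < len x → walk x i ≡ walk x j → i ≡ j
    walk-injective x i j hi hj e with even⊎odd i | even⊎odd j
    ... | a , inj₁ refl | b , inj₁ refl =
      cong (λ k → k + k) (Φ-injective-within-period x a b (m+m<n+n⇒m<n hi) (m+m<n+n⇒m<n hj)
        (trans (sym (walk-even a x)) (trans e (walk-even b x))))
    ... | a , inj₂ refl | b , inj₂ refl =
      cong (λ k → suc (k + k)) (Φ-injective-within-period x a b (m+m<n+n⇒m<n (<-trans (n<1+n _) hi))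
                                   (m+m<n+n⇒m<n (<-trans (n<1+n _) hj))
        (trans (sym (α-invol _)) (trans (cong α (trans (sym (walk-odd a x)) (trans e (walk-odd b x)))) (α-invol _))))
    ... | a , inj₁ refl | b , inj₂ refl =
      ⊥-elim (Φ≢αΦ a b x (trans (sym (walk-even a x)) (trans e (walk-odd b x))))
    ... | a , inj₂ refl | b , inj₁ refl =
      ⊥-elim (Φ≢αΦ b a x (trans (sym (walk-even b x)) (trans (sym e) (walk-odd a x))))

Closed : ∀ {n} → (Fin n → Bool) → (Fin n → Fin n) → Set
Closed S f = ∀ x → S x ≡ true → S (f x) ≡ true

-- Following α, β, α, β, … from a fixed point a of β leads to another fixed point
-- `endpoint a` of β; this pairs up the fixed points of β.
module PathEndpoints {n : ℕ} (α β : Fin n → Fin n)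
         (α-invol : ∀ x → α (α x) ≡ x) (β-invol : ∀ x → β (β x) ≡ x)
         (α-fpf : ∀ x → α x ≢ x) (A : Fin n → Bool)
         (β-fixes-A : ∀ x → A x ≡ true → β x ≡ x) (β-moves-off-A : ∀ x → A x ≡ false → β x ≢ x) where
  open Alternating α β α-invol β-invol

  β-fixed⇒A : ∀ x → β x ≡ x → A x ≡ true
  β-fixed⇒A x e with A x in eq
  ... | true = refl
  ... | false = ⊥-elim (β-moves-off-A x eq e)

  A-β⇒A : ∀ y → A (β y) ≡ true → A y ≡ true
  A-β⇒A y h = subst (λ z → A z ≡ true) (trans (sym (β-fixes-A (β y) h)) (β-invol y)) h

  Hits : Fin n → ℕ → Set
  Hits a k = A (α (Φ k a)) ≡ true

  hits? : ∀ a k → Dec (Hits a k)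
  hits? a k = A (α (Φ k a)) BP.≟ true

  hits-within-period : ∀ a → A a ≡ true → ∃ λ q → q < Period.p (period a) × Hits a q
  hits-within-period a Aa with walk-reaches-β a (Period.p (period a)) (Period.p>0 (period a)) (Period.returns (period a))
  ... | q , e , w = q , subst (q <_) (sym e) (n<1+n q) ,
          subst (λ z → A z ≡ true) (sym (trans (sym (walk-odd q a)) (trans w (β-fixes-A a Aa)))) Aa

  module _ (a : Fin n) where
    open LeastWitness (hits? a) public

  endpointOf : ∀ a → (∃ λ k → k ≤ Period.p (period a) × Least a k) ⊎
                     (∀ j → j ≤ Period.p (period a) → ¬ Hits a j) →
               Fin n
  endpointOf a (inj₁ (k , _ , _)) = α (Φ k a)
  endpointOf a (inj₂ _) = a

  abstract
    endpoint : Fin n → Fin n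
    endpoint a = endpointOf a (search a (Period.p (period a)))

    endpoint-spec : ∀ a → A a ≡ true → ∃ λ k → Least a k × endpoint a ≡ α (Φ k a)
    endpoint-spec a Aa with search a (Period.p (period a))
    ... | inj₁ (k , _ , l) = k , l , refl
    ... | inj₂ none with hits-within-period a Aa
    ...   | q , q< , h = ⊥-elim (none q (<⇒≤ q<) h)

  endpoint-A : ∀ a → A a ≡ true → A (endpoint a) ≡ true
  endpoint-A a Aa with endpoint-spec a Aa
  ... | k , (h , _) , e = subst (λ z → A z ≡ true) (sym e) h

  endpoint-≢ : ∀ a → A a ≡ true → endpoint a ≢ a
  endpoint-≢ a Aa e0 with endpoint-spec a Aa
  ... | k , (h , earliest) , e with Φ≡α⇒turn k a (trans (sym (α-invol _)) (cong α (trans (sym e) e0)))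
  ...   | t , inj₁ (_ , f) = α-fpf _ f
  ...   | t , inj₂ (refl , f) = earliest t (s≤s (m≤m+n t t)) (β-fixed⇒A _ f)

  reversed-path-least : ∀ a k → A a ≡ true → Least a k → Least (α (Φ k a)) k
  reversed-path-least a k Aa (_ , earliest) = hit′ , earliest′
    where
    hit′ : Hits (α (Φ k a)) k
    hit′ = subst (λ z → A z ≡ true) (sym (Φ-reverse-full k a)) Aa
    earliest′ : ∀ j → j < k → ¬ Hits (α (Φ k a)) j
    earliest′ j j<k hit with m≤n⇒∃[o]m+o≡n j<k
    ... | o , refl = earliest o (s≤s (m≤n+m o j)) (A-β⇒A _ (subst (λ z → A z ≡ true) (Φ-reverse j (suc o) a) hit″))
      where
      hit″ : A (α (Φ j (α (Φ (j + suc o) a)))) ≡ true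
      hit″ = subst (λ t → A (α (Φ j (α (Φ t a)))) ≡ true) (sym (+-suc j o)) hit

  endpoint-involutive : ∀ a → A a ≡ true → endpoint (endpoint a) ≡ a
  endpoint-involutive a Aa with endpoint-spec a Aa
  ... | k , least , e with endpoint-spec (α (Φ k a)) (proj₁ least)
  ...   | k′ , least′ , e′ = begin
    endpoint (endpoint a)      ≡⟨ cong endpoint e ⟩
    endpoint (α (Φ k a))       ≡⟨ e′ ⟩
    α (Φ k′ (α (Φ k a)))       ≡⟨ cong (λ t → α (Φ t (α (Φ k a)))) k′≡k ⟩
    α (Φ k (α (Φ k a)))        ≡⟨ Φ-reverse-full k a ⟩
    a                          ∎
    where
    open ≡-Reasoning
    k′≡k : k′ ≡ k
    k′≡k = least-unique (α (Φ k a)) least′ (reversed-path-least a k Aa least)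

  endpoint-reachable : ∀ (S : Fin n → Bool) → Closed S α →
                       (∀ x → A x ≡ false → S x ≡ true → S (β x) ≡ true) →
                       ∀ a → A a ≡ true → S a ≡ true → S (endpoint a) ≡ true
  endpoint-reachable S S-α S-β a Aa Sa with endpoint-spec a Aa
  ... | k , (_ , earliest) , e = subst (λ z → S z ≡ true) (sym e) (S-α _ (along k ≤-refl))
    where
    not-A : ∀ j → j < k → A (α (Φ j a)) ≡ false
    not-A j j<k with A (α (Φ j a)) in eq
    ... | true = ⊥-elim (earliest j j<k eq)
    ... | false = refl
    along : ∀ j → j ≤ k → S (Φ j a) ≡ true
    along zero _ = Sa
    along (suc j) j<k = S-β _ (not-A j j<k) (S-α _ (along j (<⇒≤ j<k)))

-- The root of a vertex is the least vertex of its cycle in α ∪ β, and `rootEdge` marks the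
-- β-edge at the root of every cycle.
module Cycles {n : ℕ} (α β : Fin n → Fin n)
         (α-invol : ∀ x → α (α x) ≡ x) (β-invol : ∀ x → β (β x) ≡ x)
         (α-fpf : ∀ x → α x ≢ x) (β-fpf : ∀ x → β x ≢ x) where
  open Alternating α β α-invol β-invol public
  open FixedPointFree α-fpf β-fpf public

  walk-preserves : ∀ (S : Fin n → Bool) → Closed S α → Closed S β → ∀ x i → S x ≡ true → S (walk x i) ≡ true
  walk-preserves S S-α S-β x zero s = s
  walk-preserves S S-α S-β x (suc i) s with walk-step i x
  ... | inj₁ (_ , _ , e) = subst (λ z → S z ≡ true) (sym e) (S-α _ (walk-preserves S S-α S-β x i s))
  ... | inj₂ (_ , _ , e) = subst (λ z → S z ≡ true) (sym e) (S-β _ (walk-preserves S S-α S-β x i s))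

  walk-reflects : ∀ (S : Fin n → Bool) → Closed S α → Closed S β → ∀ x i → S (walk x i) ≡ true → S x ≡ true
  walk-reflects S S-α S-β x zero s = s
  walk-reflects S S-α S-β x (suc i) s with walk-step i x
  ... | inj₁ (_ , _ , e) = walk-reflects S S-α S-β x i
          (subst (λ z → S z ≡ true) (α-invol _) (S-α _ (subst (λ z → S z ≡ true) e s)))
  ... | inj₂ (_ , _ , e) = walk-reflects S S-α S-β x i
          (subst (λ z → S z ≡ true) (β-invol _) (S-β _ (subst (λ z → S z ≡ true) e s)))

  reaches-refl : ∀ x → reaches x x ≡ true
  reaches-refl x = reaches-intro (0 , refl)

  reaches-sym : ∀ {x z} → reaches x z ≡ true → reaches z x ≡ true
  reaches-sym {x} {z} h with reaches-elim h
  ... | i , _ , refl = walk-reflects (reaches (walk x i)) (λ _ → reaches-α) (λ _ → reaches-β) x i (reaches-refl _)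

  reaches-trans : ∀ {x z u} → reaches x z ≡ true → reaches z u ≡ true → reaches x u ≡ true
  reaches-trans {x} {z} {u} h h′ with reaches-elim h′
  ... | i , _ , refl = walk-preserves (reaches x) (λ _ → reaches-α) (λ _ → reaches-β) z i h

  abstract
    root : Fin n → Fin n
    root x = walk x (proj₁ (argmin-below (walk x) (len x) (len>0 x)))

    reaches-root : ∀ x → reaches x (root x) ≡ true
    reaches-root x = reaches-intro (proj₁ (argmin-below (walk x) (len x) (len>0 x)) , refl)

    root-minimal : ∀ x z → reaches x z ≡ true → toℕ (root x) ≤ toℕ z
    root-minimal x z h with reaches-elim h
    ... | j , hj , refl = proj₂ (proj₂ (argmin-below (walk x) (len x) (len>0 x))) j hj

    root-cong : ∀ {y z} → reaches y z ≡ true → root y ≡ root z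
    root-cong {y} {z} h = toℕ-injective (≤-antisym
      (root-minimal y (root z) (reaches-trans h (reaches-root z)))
      (root-minimal z (root y) (reaches-trans (reaches-sym h) (reaches-root y))))

    isRoot : Fin n → Bool
    isRoot y = isYes (root y F.≟ y)

    isRoot-root : ∀ z → isRoot (root z) ≡ true
    isRoot-root z = isYes-complete (root (root z) F.≟ root z) (sym (root-cong (reaches-root z)))

    isRoot-unique : ∀ {y y′} → isRoot y ≡ true → isRoot y′ ≡ true → reaches y y′ ≡ true → y ≡ y′
    isRoot-unique {y} {y′} s s′ h = trans (sym (isYes-sound (root y F.≟ y) s))
      (trans (root-cong h) (isYes-sound (root y′ F.≟ y′) s′))

  rootEdge : Fin n → Bool
  rootEdge x = isRoot x ∨ isRoot (β x)

  rootEdge-β : ∀ x → rootEdge (β x) ≡ rootEdge x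
  rootEdge-β x rewrite β-invol x = BP.∨-comm (isRoot (β x)) (isRoot x)

  isRoot⇒rootEdge : ∀ y → isRoot y ≡ true → rootEdge y ≡ true
  isRoot⇒rootEdge y y-root rewrite y-root = refl

  rootEdge⇒isRoot : ∀ x → rootEdge x ≡ true → isRoot x ≡ true ⊎ isRoot (β x) ≡ true
  rootEdge⇒isRoot x h with isRoot x
  ... | true = inj₁ refl
  ... | false = inj₂ h

  last-spec : ∀ y → ∃ λ q → len y ≡ suc (suc (q + q)) × walk y (suc (q + q)) ≡ β y
  last-spec y with walk-reaches-β y (Period.p (period y)) (Period.p>0 (period y)) (Period.returns (period y))
  ... | q , e , w = q , trans (cong (λ k → k + k) e) (suc+suc q) , w

  last : Fin n → ℕ
  last y = suc (proj₁ (last-spec y) + proj₁ (last-spec y))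

  last<len : ∀ y → last y < len y
  last<len y = subst (last y <_) (sym (proj₁ (proj₂ (last-spec y)))) ≤-refl

  walk-last : ∀ y → walk y (last y) ≡ β y
  walk-last y = proj₂ (proj₂ (last-spec y))

  ≤last : ∀ y i → i < len y → i ≤ last y
  ≤last y i h = s≤s⁻¹ (subst (i <_) (proj₁ (proj₂ (last-spec y))) h)

  ¬rootEdge-inside : ∀ y → isRoot y ≡ true → ∀ i → 0 < i → i < last y → rootEdge (walk y i) ≡ false
  ¬rootEdge-inside y sy i i>0 i<l with isRoot (walk y i) in e1 | isRoot (β (walk y i)) in e2
  ... | true | _ = ⊥-elim (<-irrefl (walk-injective y 0 i (len>0 y) hi
                       (isRoot-unique sy e1 (reaches-intro (i , refl)))) i>0)
    where hi = <-trans i<l (last<len y)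
  ... | false | true = ⊥-elim (<-irrefl (walk-injective y i (last y) hi (last<len y) eq) i<l)
    where
    hi = <-trans i<l (last<len y)
    eq : walk y i ≡ walk y (last y)
    eq = trans (sym (β-invol _)) (trans (cong β (sym (isRoot-unique sy e2 (reaches-β (reaches-intro (i , refl))))))
           (sym (walk-last y)))
  ... | false | false = refl

  module AlongCycle (S : Fin n → Bool) (S-α : Closed S α)
           (S-β : ∀ x → rootEdge x ≡ false → S x ≡ true → S (β x) ≡ true)
           (y : Fin n) (sy : isRoot y ≡ true) where
    forward : S y ≡ true → ∀ i → i ≤ last y → S (walk y i) ≡ true
    forward s zero _ = s
    forward s (suc i) h with walk-step i y
    ... | inj₁ (_ , _ , e) = subst (λ z → S z ≡ true) (sym e) (S-α _ (forward s i (<⇒≤ h)))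
    ... | inj₂ (k , refl , e) = subst (λ z → S z ≡ true) (sym e)
            (S-β _ (¬rootEdge-inside y sy _ (s≤s z≤n) h) (forward s _ (<⇒≤ h)))

    backward : ∀ i → i ≤ last y → S (walk y i) ≡ true → S y ≡ true
    backward zero _ s = s
    backward (suc i) h s with walk-step i y
    ... | inj₁ (_ , _ , e) = backward i (<⇒≤ h)
            (subst (λ z → S z ≡ true) (α-invol _) (S-α _ (subst (λ z → S z ≡ true) e s)))
    ... | inj₂ (k , refl , e) = backward _ (<⇒≤ h)
            (subst (λ z → S z ≡ true) (trans (cong β e) (β-invol _)) (S-β _ (¬rootEdge-inside y sy _ (s≤s z≤n) lt) s))
      where
      ne : suc (suc (k + k)) ≢ last y
      ne e′ = odd≢even (proj₁ (last-spec y)) (suc k) (trans (sym e′) (sym (suc+suc k)))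
      lt : suc (suc (k + k)) < last y
      lt = ≤∧≢⇒< h ne

  representative : ∀ z → ∃ λ y → isRoot y ≡ true × ∃ λ i → i ≤ last y × walk y i ≡ z
  representative z with reaches-elim (reaches-sym (reaches-root z))
  ... | i , hi , e = root z , isRoot-root z , i , ≤last (root z) i hi , e

-- Pairings whose union is a Hamiltonian cycle

Connected : ∀ {n} → (Fin n → Fin n) → (Fin n → Fin n) → Set
Connected {n} M N = ∀ (S : Fin n → Bool) → Closed S M → Closed S N → ∀ x y → S x ≡ true → S y ≡ true

HamiltonianUnion : ∀ {n} → (Fin n → Fin n) → (Fin n → Fin n) → Set
HamiltonianUnion {n} M N = Σ (Fin n → Fin n) λ v → Injective _≡_ _≡_ v ×
  (∀ x y → ((M x ≡ y) ⊎ (N x ≡ y)) ⇔ CycleEdge v x y)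

-- The Hamiltonian cycle is the alternating walk from vertex 0, which by connectivity visits
-- every vertex before it closes up.
module CycleOfConnectedUnion {m : ℕ} (M N : Fin (suc m) → Fin (suc m))
         (M-invol : ∀ x → M (M x) ≡ x) (N-invol : ∀ x → N (N x) ≡ x)
         (M-fpf : ∀ x → M x ≢ x) (N-fpf : ∀ x → N x ≢ x) (connected : Connected M N) where
  open Alternating M N M-invol N-invol
  open FixedPointFree M-fpf N-fpf

  x₀ : Fin (suc m)
  x₀ = F.zero

  p L : ℕ
  p = Period.p (period x₀)
  L = len x₀

  reaches-all : ∀ z → reaches x₀ z ≡ true
  reaches-all z = connected (reaches x₀) (λ _ → reaches-α) (λ _ → reaches-β) x₀ z (reaches-intro (0 , refl))

  position : Fin (suc m) → Fin L
  position z = fromℕ< (proj₁ (proj₂ (reaches-elim (reaches-all z))))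

  walk-position : ∀ z → walk x₀ (toℕ (position z)) ≡ z
  walk-position z = trans (cong (walk x₀) (toℕ-fromℕ< (proj₁ (proj₂ (reaches-elim (reaches-all z))))))
                          (proj₂ (proj₂ (reaches-elim (reaches-all z))))

  len≡order : L ≡ suc m
  len≡order = cantor-schröder-bernstein {f = λ i → walk x₀ (toℕ i)} {g = position}
    (λ e → toℕ-injective (walk-injective x₀ _ _ (toℕ<n _) (toℕ<n _) e))
    (λ {a} {b} e → trans (sym (walk-position a)) (trans (cong (λ i → walk x₀ (toℕ i)) e) (walk-position b)))

  <len : ∀ {a} → a < suc m → a < L
  <len {a} = subst (a <_) (sym len≡order)

  <order : ∀ {a} → a < L → a < suc m
  <order {a} = subst (a <_) len≡order

  cycle : Fin (suc m) → Fin (suc m)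
  cycle i = walk x₀ (toℕ i)

  cycle-injective : Injective _≡_ _≡_ cycle
  cycle-injective e = toℕ-injective (walk-injective x₀ _ _ (<len (toℕ<n _)) (<len (toℕ<n _)) e)

  walk-last≡N : walk x₀ m ≡ N x₀
  walk-last≡N with walk-reaches-β x₀ p (Period.p>0 (period x₀)) (Period.returns (period x₀))
  ... | q , p≡1+q , walk-q = trans (cong (walk x₀) m≡2q+1) walk-q
    where
    m≡2q+1 : m ≡ suc (q + q)
    m≡2q+1 = suc-injective (trans (sym len≡order) (trans (cong (λ k → k + k) p≡1+q) (suc+suc q)))

  even+1<len : ∀ a → a + a < L → suc (a + a) < L
  even+1<len a h = <-≤-trans (n<1+n _) (subst (_≤ L) (suc+suc a) (+-mono-≤ a<p a<p))
    where
    a<p : a < p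
    a<p = m+m<n+n⇒m<n h

  CyclicSuccℕ : ℕ → ℕ → Set
  CyclicSuccℕ a b = suc a ≡ b ⊎ (suc a ≡ suc m × b ≡ 0)

  cyclicSucc : ∀ {a b} (ha : a < suc m) (hb : b < suc m) → CyclicSuccℕ a b →
               CyclicSucc (fromℕ< ha) (fromℕ< hb)
  cyclicSucc ha hb c rewrite toℕ-fromℕ< ha | toℕ-fromℕ< hb = c

  cycleEdge-forward : ∀ {a b} (ha : a < suc m) (hb : b < suc m) → CyclicSuccℕ a b →
                      CycleEdge cycle (walk x₀ a) (walk x₀ b)
  cycleEdge-forward ha hb c = fromℕ< ha , fromℕ< hb , cyclicSucc ha hb c ,
    inj₁ (cong (walk x₀) (toℕ-fromℕ< ha) , cong (walk x₀) (toℕ-fromℕ< hb))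

  cycleEdge-backward : ∀ {a b} (ha : a < suc m) (hb : b < suc m) → CyclicSuccℕ a b →
                       CycleEdge cycle (walk x₀ b) (walk x₀ a)
  cycleEdge-backward ha hb c = fromℕ< ha , fromℕ< hb , cyclicSucc ha hb c ,
    inj₂ (cong (walk x₀) (toℕ-fromℕ< ha) , cong (walk x₀) (toℕ-fromℕ< hb))

  cyclicSucc⇒edge : ∀ i j → CyclicSucc i j → (M (cycle i) ≡ cycle j) ⊎ (N (cycle i) ≡ cycle j)
  cyclicSucc⇒edge i j (inj₁ e) with walk-step (toℕ i) x₀
  ... | inj₁ (_ , _ , w) = inj₁ (trans (sym w) (cong (walk x₀) e))
  ... | inj₂ (_ , _ , w) = inj₂ (trans (sym w) (cong (walk x₀) e))
  cyclicSucc⇒edge i j (inj₂ (i≡m , j≡0)) =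
    inj₂ (trans (cong N (trans (cong (walk x₀) (suc-injective i≡m)) walk-last≡N))
                (trans (N-invol x₀) (cong (walk x₀) (sym j≡0))))

  cycleEdge⇒edge : ∀ x y → CycleEdge cycle x y → (M x ≡ y) ⊎ (N x ≡ y)
  cycleEdge⇒edge _ _ (i , j , c , inj₁ (refl , refl)) = cyclicSucc⇒edge i j c
  cycleEdge⇒edge _ _ (i , j , c , inj₂ (refl , refl)) with cyclicSucc⇒edge i j c
  ... | inj₁ e = inj₁ (trans (cong M (sym e)) (M-invol _))
  ... | inj₂ e = inj₂ (trans (cong N (sym e)) (N-invol _))

  M-edge-on-cycle : ∀ k → k < L → CycleEdge cycle (walk x₀ k) (M (walk x₀ k))
  M-edge-on-cycle k k<L with even⊎odd k
  ... | a , inj₁ refl =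
    subst (CycleEdge cycle _) (trans (walk-odd a x₀) (cong M (sym (walk-even a x₀))))
      (cycleEdge-forward (<order k<L) (<order (even+1<len a k<L)) (inj₁ refl))
  ... | a , inj₂ refl =
    subst (CycleEdge cycle _) (trans (walk-even a x₀) (trans (sym (M-invol _)) (cong M (sym (walk-odd a x₀)))))
      (cycleEdge-backward (<order (<-trans (n<1+n _) k<L)) (<order k<L) (inj₁ refl))

  N-edge-on-cycle : ∀ k → k < L → CycleEdge cycle (walk x₀ k) (N (walk x₀ k))
  N-edge-on-cycle k k<L with even⊎odd k
  ... | zero , inj₁ refl =
    subst (CycleEdge cycle _) walk-last≡N (cycleEdge-backward (n<1+n m) (s≤s z≤n) (inj₂ (refl , refl)))
  ... | suc b , inj₁ refl =
    subst (CycleEdge cycle _) (trans (walk-odd b x₀) (trans (sym (N-invol _)) (cong N (sym (walk-even (suc b) x₀)))))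
      (subst (λ z → CycleEdge cycle (walk x₀ z) (walk x₀ (suc (b + b)))) (sym (suc+suc b))
        (cycleEdge-backward (<order (<-trans (n<1+n _) 2b+2<L)) (<order 2b+2<L) (inj₁ refl)))
    where
    2b+2<L : suc (suc (b + b)) < L
    2b+2<L = subst (_< L) (suc+suc b) k<L
  ... | a , inj₂ refl with suc (suc (a + a)) <? L
  ...   | yes 2a+2<L =
    subst (CycleEdge cycle _) (trans (cong (walk x₀) (sym (suc+suc a)))
                                (trans (walk-even (suc a) x₀) (cong N (sym (walk-odd a x₀)))))
      (cycleEdge-forward (<order k<L) (<order 2a+2<L) (inj₁ refl))
  ...   | no 2a+2≮L =
    subst (CycleEdge cycle _) wrap (cycleEdge-forward (<order k<L) (s≤s z≤n) (inj₂ (2a+2≡1+m , refl)))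
    where
    2a+2≡1+m : suc (suc (a + a)) ≡ suc m
    2a+2≡1+m = trans (≤-antisym k<L (≮⇒≥ 2a+2≮L)) len≡order
    wrap : walk x₀ 0 ≡ N (walk x₀ (suc (a + a)))
    wrap = sym (trans (cong N (trans (cong (walk x₀) (suc-injective 2a+2≡1+m)) walk-last≡N)) (N-invol x₀))

  edge⇒cycleEdge : ∀ x y → (M x ≡ y) ⊎ (N x ≡ y) → CycleEdge cycle x y
  edge⇒cycleEdge x y e with reaches-elim (reaches-all x)
  edge⇒cycleEdge _ _ (inj₁ refl) | k , k<L , refl = M-edge-on-cycle k k<L
  edge⇒cycleEdge _ _ (inj₂ refl) | k , k<L , refl = N-edge-on-cycle k k<L

connected⇒hamiltonian : ∀ {n} (M N : Fin n → Fin n) → (∀ x → M (M x) ≡ x) → (∀ x → N (N x) ≡ x) →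
                        (∀ x → M x ≢ x) → (∀ x → N x ≢ x) → Connected M N → HamiltonianUnion M N
connected⇒hamiltonian {zero} M N _ _ _ _ _ = (λ ()) , (λ { {()} }) , λ ()
connected⇒hamiltonian {suc m} M N M-invol N-invol M-fpf N-fpf connected =
  cycle , cycle-injective , λ x y → mk⇔ (edge⇒cycleEdge x y) (cycleEdge⇒edge x y)
  where open CycleOfConnectedUnion M N M-invol N-invol M-fpf N-fpf connected

injective⇒surjective : ∀ {m} (v : Fin m → Fin m) → Injective _≡_ _≡_ v → ∀ y → ∃ λ i → v i ≡ y
injective⇒surjective {suc m} v v-injective y with FP.any? (λ i → v i F.≟ y)
... | yes hit = hit
... | no miss = ⊥-elim (<-irrefl refl (injective⇒≤ {f = f} f-injective))
  where
  y≢v : ∀ i → y ≢ v i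
  y≢v i e = miss (i , sym e)
  f : Fin (suc m) → Fin m
  f i = F.punchOut (y≢v i)
  f-injective : Injective _≡_ _≡_ f
  f-injective {a} {b} e = v-injective (FP.punchOut-injective (y≢v a) (y≢v b) e)

module ConnectedOfCycle {m : ℕ} (M N : Fin (suc m) → Fin (suc m)) (v : Fin (suc m) → Fin (suc m))
         (v-injective : Injective _≡_ _≡_ v) (edges : ∀ x y → ((M x ≡ y) ⊎ (N x ≡ y)) ⇔ CycleEdge v x y)
         (S : Fin (suc m) → Bool) (S-M : Closed S M) (S-N : Closed S N) where

  step : ∀ i j → CyclicSucc i j → S (v i) ≡ true → S (v j) ≡ true
  step i j c si with Equivalence.from (edges (v i) (v j)) (i , j , c , inj₁ (refl , refl))
  ... | inj₁ e = subst (λ z → S z ≡ true) e (S-M _ si)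
  ... | inj₂ e = subst (λ z → S z ≡ true) e (S-N _ si)

  climb : ∀ a (ha : a < suc m) → S (v (fromℕ< ha)) ≡ true →
          ∀ d (hd : a + d < suc m) → S (v (fromℕ< hd)) ≡ true
  climb a ha s zero hd = subst (λ z → S (v z) ≡ true) (FP.fromℕ<-cong a (a + 0) (sym (+-identityʳ a)) ha hd) s
  climb a ha s (suc d) hd = step (fromℕ< hd′) (fromℕ< hd) succ (climb a ha s d hd′)
    where
    hd′ : a + d < suc m
    hd′ = <-trans (+-monoʳ-< a (n<1+n d)) hd
    succ : CyclicSucc (fromℕ< hd′) (fromℕ< hd)
    succ = inj₁ (trans (cong suc (toℕ-fromℕ< hd′)) (trans (sym (+-suc a d)) (sym (toℕ-fromℕ< hd))))

  reaches-first : ∀ i → S (v i) ≡ true → S (v F.zero) ≡ true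
  reaches-first i s = step (fromℕ< top) F.zero (inj₂ (cong suc (trans (toℕ-fromℕ< top) i+[m∸i]≡m) , refl))
                           (climb (toℕ i) (toℕ<n i) s′ (m ∸ toℕ i) top)
    where
    i+[m∸i]≡m : toℕ i + (m ∸ toℕ i) ≡ m
    i+[m∸i]≡m = m+[n∸m]≡n (s≤s⁻¹ (toℕ<n i))
    top : toℕ i + (m ∸ toℕ i) < suc m
    top = subst (_< suc m) (sym i+[m∸i]≡m) (n<1+n m)
    s′ : S (v (fromℕ< (toℕ<n i))) ≡ true
    s′ = subst (λ z → S (v z) ≡ true) (sym (fromℕ<-toℕ i (toℕ<n i))) s

  reaches-every : S (v F.zero) ≡ true → ∀ j → S (v j) ≡ true
  reaches-every s j = subst (λ z → S (v z) ≡ true) (fromℕ<-toℕ j (toℕ<n j))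
                        (climb 0 (s≤s z≤n) s (toℕ j) (toℕ<n j))

  closed⇒all : ∀ x y → S x ≡ true → S y ≡ true
  closed⇒all x y Sx with injective⇒surjective v v-injective x | injective⇒surjective v v-injective y
  ... | i , refl | j , refl = reaches-every (reaches-first i Sx) j

hamiltonian⇒connected : ∀ {n} (M N : Fin n → Fin n) → HamiltonianUnion M N → Connected M N
hamiltonian⇒connected {zero} M N _ S _ _ ()
hamiltonian⇒connected {suc m} M N (v , v-injective , edges) S S-M S-N =
  ConnectedOfCycle.closed⇒all M N v v-injective edges S S-M S-N

-- Pairings of the prism

module Layers (n : ℕ) where
  copy₁ : Fin n → Fin (n + n)
  copy₁ a = a ↑ˡ n

  copy₂ : Fin n → Fin (n + n)
  copy₂ a = n ↑ʳ a

  splitAt-copy₁ : ∀ a → splitAt n (copy₁ a) ≡ inj₁ a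
  splitAt-copy₁ a = splitAt-↑ˡ n a n

  splitAt-copy₂ : ∀ a → splitAt n (copy₂ a) ≡ inj₂ a
  splitAt-copy₂ a = splitAt-↑ʳ n n a

  copy₁-injective : ∀ {a b} → copy₁ a ≡ copy₁ b → a ≡ b
  copy₁-injective = ↑ˡ-injective n _ _

  copy₂-injective : ∀ {a b} → copy₂ a ≡ copy₂ b → a ≡ b
  copy₂-injective = ↑ʳ-injective n _ _

  copy₁≢copy₂ : ∀ {a b} → copy₁ a ≢ copy₂ b
  copy₁≢copy₂ {a} {b} e with trans (sym (splitAt-copy₁ a)) (trans (cong (splitAt n) e) (splitAt-copy₂ b))
  ... | ()

  copy-cases : ∀ z → (∃ λ a → z ≡ copy₁ a) ⊎ (∃ λ b → z ≡ copy₂ b)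
  copy-cases z with splitAt n z in eq
  ... | inj₁ a = inj₁ (a , sym (splitAt⁻¹-↑ˡ eq))
  ... | inj₂ b = inj₂ (b , sym (splitAt⁻¹-↑ʳ eq))

  all-copies : ∀ (S : Fin (n + n) → Bool) → (∀ a → S (copy₁ a) ≡ true) → (∀ b → S (copy₂ b) ≡ true) →
               ∀ z → S z ≡ true
  all-copies S S₁ S₂ z with copy-cases z
  ... | inj₁ (a , refl) = S₁ a
  ... | inj₂ (b , refl) = S₂ b

  prismAdj-copy₁ : ∀ (e : Fin n → Fin n → Bool) a b → prismAdj n e (copy₁ a) (copy₁ b) ≡ e a b
  prismAdj-copy₁ e a b rewrite splitAt-copy₁ a | splitAt-copy₁ b = refl

  prismAdj-copy₂ : ∀ (e : Fin n → Fin n → Bool) a b → prismAdj n e (copy₂ a) (copy₂ b) ≡ e a b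
  prismAdj-copy₂ e a b rewrite splitAt-copy₂ a | splitAt-copy₂ b = refl

  prismAdj-rung₁₂ : ∀ (e : Fin n → Fin n → Bool) a → prismAdj n e (copy₁ a) (copy₂ a) ≡ true
  prismAdj-rung₁₂ e a rewrite splitAt-copy₁ a | splitAt-copy₂ a = isYes-complete (a F.≟ a) refl

  prismAdj-rung₂₁ : ∀ (e : Fin n → Fin n → Bool) a → prismAdj n e (copy₂ a) (copy₁ a) ≡ true
  prismAdj-rung₂₁ e a rewrite splitAt-copy₁ a | splitAt-copy₂ a = isYes-complete (a F.≟ a) refl

  -- A pairing m of the prism consists of its pairs M₁, M₂ inside the two copies, extended by
  -- the identity on the sets A, B of vertices that m matches across, and the bijection X : A → B.
  module PrismPairing (m : Fin (n + n) → Fin (n + n)) (m-invol : ∀ z → m (m z) ≡ z) (m-fpf : ∀ z → m z ≢ z) where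
    A : Fin n → Bool
    A a = [ (λ _ → false) , (λ _ → true) ]′ (splitAt n (m (copy₁ a)))

    M₁ : Fin n → Fin n
    M₁ a = [ (λ b → b) , (λ _ → a) ]′ (splitAt n (m (copy₁ a)))

    X : Fin n → Fin n
    X a = [ (λ _ → a) , (λ b → b) ]′ (splitAt n (m (copy₁ a)))

    B : Fin n → Bool
    B b = [ (λ _ → true) , (λ _ → false) ]′ (splitAt n (m (copy₂ b)))

    M₂ : Fin n → Fin n
    M₂ b = [ (λ _ → b) , (λ a → a) ]′ (splitAt n (m (copy₂ b)))

    X⁻¹ : Fin n → Fin n
    X⁻¹ b = [ (λ a → a) , (λ _ → b) ]′ (splitAt n (m (copy₂ b)))

    m-copy₁-cases : ∀ a → (A a ≡ false × m (copy₁ a) ≡ copy₁ (M₁ a)) ⊎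
                          (A a ≡ true × m (copy₁ a) ≡ copy₂ (X a))
    m-copy₁-cases a with splitAt n (m (copy₁ a)) in eq
    ... | inj₁ b = inj₁ (refl , sym (splitAt⁻¹-↑ˡ eq))
    ... | inj₂ b = inj₂ (refl , sym (splitAt⁻¹-↑ʳ eq))

    m-copy₂-cases : ∀ b → (B b ≡ false × m (copy₂ b) ≡ copy₂ (M₂ b)) ⊎
                          (B b ≡ true × m (copy₂ b) ≡ copy₁ (X⁻¹ b))
    m-copy₂-cases b with splitAt n (m (copy₂ b)) in eq
    ... | inj₁ a = inj₂ (refl , sym (splitAt⁻¹-↑ˡ eq))
    ... | inj₂ a = inj₁ (refl , sym (splitAt⁻¹-↑ʳ eq))

    m-copy₁-within : ∀ a → A a ≡ false → m (copy₁ a) ≡ copy₁ (M₁ a)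
    m-copy₁-within a h with m-copy₁-cases a
    ... | inj₁ (_ , e) = e
    ... | inj₂ (h′ , _) with trans (sym h) h′
    ...   | ()

    m-copy₁-across : ∀ a → A a ≡ true → m (copy₁ a) ≡ copy₂ (X a)
    m-copy₁-across a h with m-copy₁-cases a
    ... | inj₂ (_ , e) = e
    ... | inj₁ (h′ , _) with trans (sym h) h′
    ...   | ()

    m-copy₂-within : ∀ b → B b ≡ false → m (copy₂ b) ≡ copy₂ (M₂ b)
    m-copy₂-within b h with m-copy₂-cases b
    ... | inj₁ (_ , e) = e
    ... | inj₂ (h′ , _) with trans (sym h) h′
    ...   | ()

    m-copy₂-across : ∀ b → B b ≡ true → m (copy₂ b) ≡ copy₁ (X⁻¹ b)
    m-copy₂-across b h with m-copy₂-cases b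
    ... | inj₂ (_ , e) = e
    ... | inj₁ (h′ , _) with trans (sym h) h′
    ...   | ()

    M₁-within : ∀ a → A a ≡ false → A (M₁ a) ≡ false × M₁ (M₁ a) ≡ a
    M₁-within a h with m-copy₁-cases (M₁ a)
    ... | inj₁ (h′ , e) = h′ , copy₁-injective (trans (sym e) (trans (cong m (sym (m-copy₁-within a h))) (m-invol _)))
    ... | inj₂ (_ , e) = ⊥-elim (copy₁≢copy₂ (trans (sym (m-invol (copy₁ a))) (trans (cong m (m-copy₁-within a h)) e)))

    M₁-fixes-A : ∀ a → A a ≡ true → M₁ a ≡ a
    M₁-fixes-A a h with splitAt n (m (copy₁ a))
    ... | inj₂ _ = refl
    ... | inj₁ _ with h
    ...   | ()

    M₁-fixedPointFree : ∀ a → A a ≡ false → M₁ a ≢ a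
    M₁-fixedPointFree a h e = m-fpf _ (trans (m-copy₁-within a h) (cong copy₁ e))

    M₁-involutive : ∀ a → M₁ (M₁ a) ≡ a
    M₁-involutive a with A a in h
    ... | true = trans (cong M₁ (M₁-fixes-A a h)) (M₁-fixes-A a h)
    ... | false = proj₂ (M₁-within a h)

    M₂-within : ∀ b → B b ≡ false → B (M₂ b) ≡ false × M₂ (M₂ b) ≡ b
    M₂-within b h with m-copy₂-cases (M₂ b)
    ... | inj₁ (h′ , e) = h′ , copy₂-injective (trans (sym e) (trans (cong m (sym (m-copy₂-within b h))) (m-invol _)))
    ... | inj₂ (_ , e) = ⊥-elim (copy₁≢copy₂ (sym (trans (sym (m-invol (copy₂ b))) (trans (cong m (m-copy₂-within b h)) e))))

    M₂-fixedPointFree : ∀ b → B b ≡ false → M₂ b ≢ b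
    M₂-fixedPointFree b h e = m-fpf _ (trans (m-copy₂-within b h) (cong copy₂ e))

    X-B : ∀ a → A a ≡ true → B (X a) ≡ true × X⁻¹ (X a) ≡ a
    X-B a h with m-copy₂-cases (X a)
    ... | inj₂ (h′ , e) = h′ , copy₁-injective (trans (sym e) (trans (cong m (sym (m-copy₁-across a h))) (m-invol _)))
    ... | inj₁ (_ , e) = ⊥-elim (copy₁≢copy₂ (trans (sym (m-invol (copy₁ a))) (trans (cong m (m-copy₁-across a h)) e)))

    X⁻¹-A : ∀ b → B b ≡ true → A (X⁻¹ b) ≡ true × X (X⁻¹ b) ≡ b
    X⁻¹-A b h with m-copy₁-cases (X⁻¹ b)
    ... | inj₂ (h′ , e) = h′ , copy₂-injective (trans (sym e) (trans (cong m (sym (m-copy₂-across b h))) (m-invol _)))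
    ... | inj₁ (_ , e) = ⊥-elim (copy₁≢copy₂ (sym (trans (sym (m-invol (copy₂ b))) (trans (cong m (m-copy₂-across b h)) e))))

evenOrder⇒pairing : ∀ n → Even n → Σ (Fin n → Fin n) λ σ → (∀ x → σ (σ x) ≡ x) × (∀ x → σ x ≢ x)
evenOrder⇒pairing .(k + k) (k , refl) = σ , σ-invol , σ-fpf
  where
  open Layers k
  σ : Fin (k + k) → Fin (k + k)
  σ z = [ copy₂ , copy₁ ]′ (splitAt k z)
  σ-copy₁ : ∀ a → σ (copy₁ a) ≡ copy₂ a
  σ-copy₁ a rewrite splitAt-copy₁ a = refl
  σ-copy₂ : ∀ a → σ (copy₂ a) ≡ copy₁ a
  σ-copy₂ a rewrite splitAt-copy₂ a = refl
  σ-invol : ∀ z → σ (σ z) ≡ z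
  σ-invol z with copy-cases z
  ... | inj₁ (a , refl) = trans (cong σ (σ-copy₁ a)) (σ-copy₂ a)
  ... | inj₂ (a , refl) = trans (cong σ (σ-copy₂ a)) (σ-copy₁ a)
  σ-fpf : ∀ z → σ z ≢ z
  σ-fpf z with copy-cases z
  ... | inj₁ (a , refl) = λ e → copy₁≢copy₂ (sym (trans (sym (σ-copy₁ a)) e))
  ... | inj₂ (a , refl) = λ e → copy₁≢copy₂ (trans (sym (σ-copy₂ a)) e)

module ExtendPrismPairing (G : Graph) (even : Even (order G)) (extend : ∀ (M : Pairing G) → Extendable G M)
         (M : Pairing (prism G)) where
  n : ℕ
  n = order G
  open Layers n

  m : Fin (n + n) → Fin (n + n)
  m = partner M
  open PrismPairing m (invol M) (noFix M)

  mkPairing : (f : Fin n → Fin n) → (∀ x → f (f x) ≡ x) → (∀ x → f x ≢ x) → Pairing G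
  mkPairing f f-invol f-fpf = record { partner = f ; invol = f-invol ; noFix = f-fpf }

  extendable-by : (N : Fin (n + n) → Fin (n + n)) → (∀ z → N (N z) ≡ z) → (∀ z → N z ≢ z) →
                  (∀ z → adj (prism G) z (N z) ≡ true) → Connected m N → Extendable (prism G) M
  extendable-by N N-invol N-fpf N-adj connected =
    record { pairing = record { partner = N ; invol = N-invol ; noFix = N-fpf } ; inGraph = N-adj } ,
    connected⇒hamiltonian m N (invol M) N-invol (noFix M) N-fpf connected

  module Crossing (a₀ : Fin n) (a₀∈A : A a₀ ≡ true) where
    σ : Σ (Fin n → Fin n) λ σ → (∀ x → σ (σ x) ≡ x) × (∀ x → σ x ≢ x)
    σ = evenOrder⇒pairing n even

    -- Any pairing of A completes M₁ to a pairing of G; the endpoints of the alternating paths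
    -- of an arbitrary pairing σ of K_G and M₁ provide one.
    module Q = PathEndpoints (proj₁ σ) M₁ (proj₁ (proj₂ σ)) M₁-involutive (proj₂ (proj₂ σ))
                 A M₁-fixes-A M₁-fixedPointFree

    P₁ : Fin n → Fin n
    P₁ x = if A x then Q.endpoint x else M₁ x

    P₁-involutive : ∀ x → P₁ (P₁ x) ≡ x
    P₁-involutive x with A x in h
    ... | true rewrite Q.endpoint-A x h = Q.endpoint-involutive x h
    ... | false rewrite proj₁ (M₁-within x h) = proj₂ (M₁-within x h)

    P₁-fpf : ∀ x → P₁ x ≢ x
    P₁-fpf x with A x in h
    ... | true = Q.endpoint-≢ x h
    ... | false = M₁-fixedPointFree x h

    N₁-matching : PerfectMatching G
    N₁-matching = proj₁ (extend (mkPairing P₁ P₁-involutive P₁-fpf))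

    N₁ : Fin n → Fin n
    N₁ = partner (pairing N₁-matching)

    P₁∪N₁-connected : Connected P₁ N₁
    P₁∪N₁-connected = hamiltonian⇒connected P₁ N₁ (proj₂ (extend (mkPairing P₁ P₁-involutive P₁-fpf)))

    module R = PathEndpoints N₁ M₁ (invol (pairing N₁-matching)) M₁-involutive (noFix (pairing N₁-matching))
                 A M₁-fixes-A M₁-fixedPointFree

    P₂ : Fin n → Fin n
    P₂ b = if B b then X (R.endpoint (X⁻¹ b)) else M₂ b

    P₂-B : ∀ b → B b ≡ true → B (X (R.endpoint (X⁻¹ b))) ≡ true
    P₂-B b h = proj₁ (X-B _ (R.endpoint-A _ (proj₁ (X⁻¹-A b h))))

    P₂-involutive : ∀ x → P₂ (P₂ x) ≡ x
    P₂-involutive x with B x in h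
    ... | true rewrite P₂-B x h = begin
      X (R.endpoint (X⁻¹ (X (R.endpoint (X⁻¹ x)))))  ≡⟨ cong (λ z → X (R.endpoint z)) (proj₂ (X-B _ endpoint-A)) ⟩
      X (R.endpoint (R.endpoint (X⁻¹ x)))            ≡⟨ cong X (R.endpoint-involutive _ (proj₁ (X⁻¹-A x h))) ⟩
      X (X⁻¹ x)                                      ≡⟨ proj₂ (X⁻¹-A x h) ⟩
      x                                              ∎
      where
      open ≡-Reasoning
      endpoint-A : A (R.endpoint (X⁻¹ x)) ≡ true
      endpoint-A = R.endpoint-A _ (proj₁ (X⁻¹-A x h))
    ... | false rewrite proj₁ (M₂-within x h) = proj₂ (M₂-within x h)

    P₂-fpf : ∀ x → P₂ x ≢ x
    P₂-fpf x with B x in h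
    ... | true = λ e → R.endpoint-≢ (X⁻¹ x) (proj₁ (X⁻¹-A x h))
                   (trans (sym (proj₂ (X-B _ (R.endpoint-A _ (proj₁ (X⁻¹-A x h)))))) (cong X⁻¹ e))
    ... | false = M₂-fixedPointFree x h

    N₂-matching : PerfectMatching G
    N₂-matching = proj₁ (extend (mkPairing P₂ P₂-involutive P₂-fpf))

    N₂ : Fin n → Fin n
    N₂ = partner (pairing N₂-matching)

    P₂∪N₂-connected : Connected P₂ N₂
    P₂∪N₂-connected = hamiltonian⇒connected P₂ N₂ (proj₂ (extend (mkPairing P₂ P₂-involutive P₂-fpf)))

    N : Fin (n + n) → Fin (n + n)
    N z = [ (λ x → copy₁ (N₁ x)) , (λ x → copy₂ (N₂ x)) ]′ (splitAt n z)

    N-copy₁ : ∀ x → N (copy₁ x) ≡ copy₁ (N₁ x)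
    N-copy₁ x rewrite splitAt-copy₁ x = refl

    N-copy₂ : ∀ x → N (copy₂ x) ≡ copy₂ (N₂ x)
    N-copy₂ x rewrite splitAt-copy₂ x = refl

    N-involutive : ∀ z → N (N z) ≡ z
    N-involutive z with copy-cases z
    ... | inj₁ (a , refl) = trans (cong N (N-copy₁ a)) (trans (N-copy₁ _) (cong copy₁ (invol (pairing N₁-matching) a)))
    ... | inj₂ (a , refl) = trans (cong N (N-copy₂ a)) (trans (N-copy₂ _) (cong copy₂ (invol (pairing N₂-matching) a)))

    N-fpf : ∀ z → N z ≢ z
    N-fpf z with copy-cases z
    ... | inj₁ (a , refl) = λ e → noFix (pairing N₁-matching) a (copy₁-injective (trans (sym (N-copy₁ a)) e))
    ... | inj₂ (a , refl) = λ e → noFix (pairing N₂-matching) a (copy₂-injective (trans (sym (N-copy₂ a)) e))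

    N-adj : ∀ z → adj (prism G) z (N z) ≡ true
    N-adj z with copy-cases z
    ... | inj₁ (a , refl) rewrite N-copy₁ a = trans (prismAdj-copy₁ (adj G) a _) (inGraph N₁-matching a)
    ... | inj₂ (a , refl) rewrite N-copy₂ a = trans (prismAdj-copy₂ (adj G) a _) (inGraph N₂-matching a)

    module Closure (S : Fin (n + n) → Bool) (S-m : Closed S m) (S-N : Closed S N) where
      S₁ S₂ : Fin n → Bool
      S₁ x = S (copy₁ x)
      S₂ x = S (copy₂ x)

      S-subst : ∀ {z w} → z ≡ w → S z ≡ true → S w ≡ true
      S-subst e = subst (λ q → S q ≡ true) e

      S₁-N₁ : Closed S₁ N₁
      S₁-N₁ x h = S-subst (N-copy₁ x) (S-N _ h)

      S₂-N₂ : Closed S₂ N₂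
      S₂-N₂ x h = S-subst (N-copy₂ x) (S-N _ h)

      S₁-M₁-off-A : ∀ x → A x ≡ false → S₁ x ≡ true → S₁ (M₁ x) ≡ true
      S₁-M₁-off-A x x∉A h = S-subst (m-copy₁-within x x∉A) (S-m _ h)

      S-across₁₂ : ∀ a → A a ≡ true → S₁ a ≡ true → S₂ (X a) ≡ true
      S-across₁₂ a a∈A h = S-subst (m-copy₁-across a a∈A) (S-m _ h)

      S-across₂₁ : ∀ b → B b ≡ true → S₂ b ≡ true → S₁ (X⁻¹ b) ≡ true
      S-across₂₁ b b∈B h = S-subst (m-copy₂-across b b∈B) (S-m _ h)

      S₁-P₁ : (∀ a → A a ≡ true → S₁ a ≡ true → S₁ (Q.endpoint a) ≡ true) → Closed S₁ P₁
      S₁-P₁ S₁-Q x h with A x in x∈A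
      ... | true = S₁-Q x x∈A h
      ... | false = S₁-M₁-off-A x x∈A h

      -- A P₂-pair is joined by its two crossing pairs and the N₁/M₁-path in copy 1 between them.
      S₂-P₂ : Closed S₂ P₂
      S₂-P₂ x h with B x in x∈B
      ... | true = S-across₁₂ _ (R.endpoint-A _ (proj₁ (X⁻¹-A x x∈B)))
                     (R.endpoint-reachable S₁ S₁-N₁ S₁-M₁-off-A (X⁻¹ x) (proj₁ (X⁻¹-A x x∈B))
                       (S-across₂₁ x x∈B h))
      ... | false = S-subst (m-copy₂-within x x∈B) (S-m _ h)

      S₂-nonempty⇒all : ∀ b → S₂ b ≡ true → ∀ z → S z ≡ true
      S₂-nonempty⇒all b h = all-copies S S₁-all S₂-all
        where
        S₂-all : ∀ y → S₂ y ≡ true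
        S₂-all y = P₂∪N₂-connected S₂ S₂-P₂ S₂-N₂ b y h
        A⊆S₁ : ∀ a → A a ≡ true → S₁ a ≡ true
        A⊆S₁ a a∈A = S-subst (trans (m-copy₂-across _ (proj₁ (X-B a a∈A))) (cong copy₁ (proj₂ (X-B a a∈A))))
                             (S-m _ (S₂-all (X a)))
        S₁-all : ∀ y → S₁ y ≡ true
        S₁-all y = P₁∪N₁-connected S₁ (S₁-P₁ λ a a∈A _ → A⊆S₁ _ (Q.endpoint-A a a∈A)) S₁-N₁
                     a₀ y (A⊆S₁ a₀ a₀∈A)

      -- If S met no vertex of A in copy 1, then S₁ would be closed under P₁ and miss a₀.
      S₂-nonempty : ∀ u → S u ≡ true → ∃ λ b → S₂ b ≡ true
      S₂-nonempty u Su with FP.any? (λ a → (A a BP.≟ true) ×-dec (S₁ a BP.≟ true))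
      ... | yes (a , a∈A , a∈S₁) = X a , S-across₁₂ a a∈A a∈S₁
      ... | no none with copy-cases u
      ...   | inj₂ (b , refl) = b , Su
      ...   | inj₁ (x , refl) = ⊥-elim (none (a₀ , a₀∈A , P₁∪N₁-connected S₁ S₁-P₁′ S₁-N₁ x a₀ Su))
        where
        S₁-P₁′ : Closed S₁ P₁
        S₁-P₁′ = S₁-P₁ λ a a∈A a∈S₁ → ⊥-elim (none (a , a∈A , a∈S₁))

    connected : Connected m N
    connected S S-m S-N u v Su with Closure.S₂-nonempty S S-m S-N u Su
    ... | b , b∈S₂ = Closure.S₂-nonempty⇒all S S-m S-N b b∈S₂ v

  module NoCrossing (no-A : ∀ a → A a ≡ false) where
    no-B : ∀ b → B b ≡ false
    no-B b with B b in b∈B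
    ... | true with trans (sym (no-A (X⁻¹ b))) (proj₁ (X⁻¹-A b b∈B))
    ...   | ()
    no-B b | false = refl

    M₁-fpf : ∀ x → M₁ x ≢ x
    M₁-fpf x = M₁-fixedPointFree x (no-A x)

    N₁-matching : PerfectMatching G
    N₁-matching = proj₁ (extend (mkPairing M₁ M₁-involutive M₁-fpf))

    N₁ : Fin n → Fin n
    N₁ = partner (pairing N₁-matching)

    N₁-involutive : ∀ x → N₁ (N₁ x) ≡ x
    N₁-involutive = invol (pairing N₁-matching)

    M₁∪N₁-connected : Connected M₁ N₁
    M₁∪N₁-connected = hamiltonian⇒connected M₁ N₁ (proj₂ (extend (mkPairing M₁ M₁-involutive M₁-fpf)))

    module C = Cycles M₂ N₁ (λ b → proj₂ (M₂-within b (no-B b))) N₁-involutive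
                 (λ x → M₂-fixedPointFree x (no-B x)) (noFix (pairing N₁-matching))
    open C using (rootEdge; rootEdge-β; isRoot⇒rootEdge; rootEdge⇒isRoot; representative; last; walk-last)

    N : Fin (n + n) → Fin (n + n)
    N z = [ (λ x → if rootEdge x then copy₂ x else copy₁ (N₁ x)) ,
            (λ x → if rootEdge x then copy₁ x else copy₂ (N₁ x)) ]′ (splitAt n z)

    N-rung₁₂ : ∀ x → rootEdge x ≡ true → N (copy₁ x) ≡ copy₂ x
    N-rung₁₂ x h rewrite splitAt-copy₁ x | h = refl

    N-copy₁ : ∀ x → rootEdge x ≡ false → N (copy₁ x) ≡ copy₁ (N₁ x)
    N-copy₁ x h rewrite splitAt-copy₁ x | h = refl

    N-rung₂₁ : ∀ x → rootEdge x ≡ true → N (copy₂ x) ≡ copy₁ x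
    N-rung₂₁ x h rewrite splitAt-copy₂ x | h = refl

    N-copy₂ : ∀ x → rootEdge x ≡ false → N (copy₂ x) ≡ copy₂ (N₁ x)
    N-copy₂ x h rewrite splitAt-copy₂ x | h = refl

    N-involutive : ∀ z → N (N z) ≡ z
    N-involutive z with copy-cases z
    ... | inj₁ (a , refl) with rootEdge a in h
    ...   | true = trans (cong N (N-rung₁₂ a h)) (N-rung₂₁ a h)
    ...   | false = trans (cong N (N-copy₁ a h)) (trans (N-copy₁ _ (trans (rootEdge-β a) h)) (cong copy₁ (N₁-involutive a)))
    N-involutive z | inj₂ (a , refl) with rootEdge a in h
    ...   | true = trans (cong N (N-rung₂₁ a h)) (N-rung₁₂ a h)
    ...   | false = trans (cong N (N-copy₂ a h)) (trans (N-copy₂ _ (trans (rootEdge-β a) h)) (cong copy₂ (N₁-involutive a)))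

    N-fpf : ∀ z → N z ≢ z
    N-fpf z with copy-cases z
    ... | inj₁ (a , refl) with rootEdge a in h
    ...   | true = λ e → copy₁≢copy₂ (sym (trans (sym (N-rung₁₂ a h)) e))
    ...   | false = λ e → noFix (pairing N₁-matching) a (copy₁-injective (trans (sym (N-copy₁ a h)) e))
    N-fpf z | inj₂ (a , refl) with rootEdge a in h
    ...   | true = λ e → copy₁≢copy₂ (trans (sym (N-rung₂₁ a h)) e)
    ...   | false = λ e → noFix (pairing N₁-matching) a (copy₂-injective (trans (sym (N-copy₂ a h)) e))

    N-adj : ∀ z → adj (prism G) z (N z) ≡ true
    N-adj z with copy-cases z
    ... | inj₁ (a , refl) with rootEdge a in h
    ...   | true rewrite N-rung₁₂ a h = prismAdj-rung₁₂ (adj G) a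
    ...   | false rewrite N-copy₁ a h = trans (prismAdj-copy₁ (adj G) a _) (inGraph N₁-matching a)
    N-adj z | inj₂ (a , refl) with rootEdge a in h
    ...   | true rewrite N-rung₂₁ a h = prismAdj-rung₂₁ (adj G) a
    ...   | false rewrite N-copy₂ a h = trans (prismAdj-copy₂ (adj G) a _) (inGraph N₁-matching a)

    module Closure (S : Fin (n + n) → Bool) (S-m : Closed S m) (S-N : Closed S N) where
      S₁ S₂ : Fin n → Bool
      S₁ x = S (copy₁ x)
      S₂ x = S (copy₂ x)

      S-subst : ∀ {z w} → z ≡ w → S z ≡ true → S w ≡ true
      S-subst e = subst (λ q → S q ≡ true) e

      S₂-subst : ∀ {z w} → z ≡ w → S₂ z ≡ true → S₂ w ≡ true
      S₂-subst e = subst (λ q → S₂ q ≡ true) e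

      S₁-M₁ : Closed S₁ M₁
      S₁-M₁ x h = S-subst (m-copy₁-within x (no-A x)) (S-m _ h)

      S₂-M₂ : Closed S₂ M₂
      S₂-M₂ x h = S-subst (m-copy₂-within x (no-B x)) (S-m _ h)

      S₂-N₁-unmarked : ∀ x → rootEdge x ≡ false → S₂ x ≡ true → S₂ (N₁ x) ≡ true
      S₂-N₁-unmarked x x-unmarked h = S-subst (N-copy₂ x x-unmarked) (S-N _ h)

      S-rung₁₂ : ∀ x → rootEdge x ≡ true → S₁ x ≡ true → S₂ x ≡ true
      S-rung₁₂ x x-marked h = S-subst (N-rung₁₂ x x-marked) (S-N _ h)

      S-rung₂₁ : ∀ x → rootEdge x ≡ true → S₂ x ≡ true → S₁ x ≡ true
      S-rung₂₁ x x-marked h = S-subst (N-rung₂₁ x x-marked) (S-N _ h)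

      open C.AlongCycle S₂ S₂-M₂ S₂-N₁-unmarked

      -- A marked N₁-edge is bypassed by the rungs at its ends and the rest of its M₂ ∪ N₁-cycle
      -- in copy 2.
      S₁-N₁ : Closed S₁ N₁
      S₁-N₁ x h with rootEdge x in x-marked
      ... | false = S-subst (N-copy₁ x x-marked) (S-N _ h)
      ... | true with rootEdge⇒isRoot x x-marked
      ...   | inj₁ x-root = S-rung₂₁ (N₁ x) (trans (rootEdge-β x) x-marked)
                 (S₂-subst (walk-last x) (forward x x-root (S-rung₁₂ x x-marked h) (last x) ≤-refl))
      ...   | inj₂ N₁x-root = S-rung₂₁ (N₁ x) (isRoot⇒rootEdge (N₁ x) N₁x-root)
                 (backward (N₁ x) N₁x-root (last (N₁ x)) ≤-refl
                   (S₂-subst (sym (trans (walk-last (N₁ x)) (N₁-involutive x))) (S-rung₁₂ x x-marked h)))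

      S₂⇒S₁ : ∀ z → S₂ z ≡ true → ∃ λ y → S₁ y ≡ true
      S₂⇒S₁ z h with representative z
      ... | y , y-root , i , i≤last , refl =
        y , S-rung₂₁ y (isRoot⇒rootEdge y y-root) (backward y y-root i i≤last h)

      S₁-all : ∀ u → S u ≡ true → ∀ y → S₁ y ≡ true
      S₁-all u Su y with copy-cases u
      ... | inj₁ (a , refl) = M₁∪N₁-connected S₁ S₁-M₁ S₁-N₁ a y Su
      ... | inj₂ (b , refl) with S₂⇒S₁ b Su
      ...   | a , a∈S₁ = M₁∪N₁-connected S₁ S₁-M₁ S₁-N₁ a y a∈S₁

      S₂-all : (∀ y → S₁ y ≡ true) → ∀ z → S₂ z ≡ true
      S₂-all S₁-all′ z with representative z
      ... | y , y-root , i , i≤last , refl =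
        forward y y-root (S-rung₁₂ y (isRoot⇒rootEdge y y-root) (S₁-all′ y)) i i≤last

    connected : Connected m N
    connected S S-m S-N u v Su = all-copies S (S₁-all u Su) (S₂-all (S₁-all u Su)) v
      where open Closure S S-m S-N

  extendable : Extendable (prism G) M
  extendable with FP.any? (λ a → A a BP.≟ true)
  ... | yes (a₀ , a₀∈A) = extendable-by N N-involutive N-fpf N-adj connected
    where open Crossing a₀ a₀∈A
  ... | no none = extendable-by N N-involutive N-fpf N-adj connected
    where open NoCrossing (λ a → BP.¬-not λ a∈A → none (a , a∈A))

prism-preserves-PH : (G : Graph) → HasPH G → HasPH (prism G)
prism-preserves-PH G (even , extend) = (order G , refl) , ExtendPrismPairing.extendable G even extend

theorem2p1 : (G : Graph) → HasPH G → (k : ℕ) → HasPH (prismPow k G)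
theorem2p1 G h zero = h
theorem2p1 G h (suc k) = prism-preserves-PH (prismPow k G) (theorem2p1 G h k)
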